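{- Every ${\bf LK}$-derivation, possibly containing cuts, of a first-order sequent $\Gamma \vdash \Delta$ can be translated into an ${\bf L}\varepsilon$-derivation of the epsilon translation $[\Gamma]^\varepsilon \vdash [\Delta]^\varepsilon$ whose length is equal to or smaller than the length of the original ${\bf LK}$-derivation.
   Context: ${\bf LK}$ is Gentzen's classical first-order sequent calculus with atomic axioms $A \vdash A$, the usual (multiplicative) rules for $\land,\lor,\to,\neg$, weakening, contraction, cut, and the quantifier rules $\exists_r,\forall_l$ (weak) and $\forall_r,\exists_l$ (strong, with the usual eigenvariable conditions). The length of a derivation is its number of inference steps. The epsilon language: terms are built from variables, function symbols and epsilon terms $\varepsilon_x A(x)$ for formulas $A(x)$ of the epsilon language; formulas are quantifier-free, built from atoms with $\land,\lor,\to,\neg$. The epsilon translation $[A]^\varepsilon$ of a first-order formula is defined by: $[A]^\varepsilon=A$ for atoms; $[B\circ C]^\varepsilon=[B]^\varepsilon\circ[C]^\varepsilon$ for $\circ\in\{\land,\lor,\to\}$, $[\neg B]^\varepsilon=\neg[B]^\varepsilon$; $[\exists x A'(x)]^\varepsilon=[A'(\varepsilon_x A'(x))]^\varepsilon$; $[\forall x A'(x)]^\varepsilon=[A'(\varepsilon_x \neg A'(x))]^\varepsilon$. For a multiset $\Gamma$, $[\Gamma]^\varepsilon$ is obtained by translating each formula. The sequent calculus ${\bf L}\varepsilon$ (over the epsilon language) has axioms $A\vdash A$ with $A$ atomic, the same propositional rules, weakenings, contractions and cut as ${\bf LK}$ (context-splitting versions for binary rules), and the quantifier inferences $\exists_r$: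 from $\Pi\vdash\Delta,A(t)$ infer $\Pi\vdash\Delta,A(\varepsilon_x A(x))$, and $\forall_l$: from $A(t),\Pi\vdash\Delta$ infer $A(\varepsilon_x\neg A(x)),\Pi\vdash\Delta$. There are no strong quantifier rules; in place of them, eigenvariables are replaced by substitution of the corresponding epsilon terms ($\varepsilon_x\neg A(x)$ for a strong $\forall x A(x)$, $\varepsilon_x A(x)$ for a strong $\exists x A(x)$). -}

module Defs where

open import Data.Nat using (ℕ; zero; suc; _+_; _≤_)
open import Data.Vec using (Vec; []; _∷_)
open import Data.List using (List; []; _∷_; _++_; map)
open import Data.List.Relation.Binary.Permutation.Propositional using (_↭_)

-- A first-order signature: function and predicate symbols with arities.
-- (Constants are 0-ary function symbols.)  No equality, no ⊥/⊤.
record Sig : Set₁ where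
  field
    Fun    : Set
    Pred   : Set
    funAr  : Fun → ℕ
    predAr : Pred → ℕ

module _ (S : Sig) where
  open Sig S

  data Term : Set where
    var : ℕ → Term
    fun : (f : Fun) → Vec Term (funAr f) → Term

  infixr 8 _∧'_
  infixr 7 _∨'_
  infixr 6 _⇒'_

  data Formula : Set where
    atom  : (p : Pred) → Vec Term (predAr p) → Formula
    _∧'_  : Formula → Formula → Formula
    _∨'_  : Formula → Formula → Formula
    _⇒'_  : Formula → Formula → Formula
    ¬'_   : Formula → Formula
    ∀'_   : Formula → Formula   -- binds de Bruijn index 0
    ∃'_   : Formula → Formula   -- binds de Bruijn index 0

  mutual
    renT : (ℕ → ℕ) → Term → Term
    renT ρ (var x)    = var (ρ x)
    renT ρ (fun f ts) = fun f (renTs ρ ts)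

    renTs : ∀ {k} → (ℕ → ℕ) → Vec Term k → Vec Term k
    renTs ρ []       = []
    renTs ρ (t ∷ ts) = renT ρ t ∷ renTs ρ ts

  liftR : (ℕ → ℕ) → ℕ → ℕ
  liftR ρ zero    = zero
  liftR ρ (suc x) = suc (ρ x)

  renF : (ℕ → ℕ) → Formula → Formula
  renF ρ (atom p ts) = atom p (renTs ρ ts)
  renF ρ (A ∧' B)    = renF ρ A ∧' renF ρ B
  renF ρ (A ∨' B)    = renF ρ A ∨' renF ρ B
  renF ρ (A ⇒' B)    = renF ρ A ⇒' renF ρ B
  renF ρ (¬' A)      = ¬' renF ρ A
  renF ρ (∀' A)      = ∀' renF (liftR ρ) A
  renF ρ (∃' A)      = ∃' renF (liftR ρ) A

  shiftF : Formula → Formula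
  shiftF = renF suc

  mutual
    subT : (ℕ → Term) → Term → Term
    subT σ (var x)    = σ x
    subT σ (fun f ts) = fun f (subTs σ ts)

    subTs : ∀ {k} → (ℕ → Term) → Vec Term k → Vec Term k
    subTs σ []       = []
    subTs σ (t ∷ ts) = subT σ t ∷ subTs σ ts

  liftS : (ℕ → Term) → ℕ → Term
  liftS σ zero    = var zero
  liftS σ (suc x) = renT suc (σ x)

  subF : (ℕ → Term) → Formula → Formula
  subF σ (atom p ts) = atom p (subTs σ ts)
  subF σ (A ∧' B)    = subF σ A ∧' subF σ B
  subF σ (A ∨' B)    = subF σ A ∨' subF σ B
  subF σ (A ⇒' B)    = subF σ A ⇒' subF σ B
  subF σ (¬' A)      = ¬' subF σ A
  subF σ (∀' A)      = ∀' subF (liftS σ) A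
  subF σ (∃' A)      = ∃' subF (liftS σ) A

  sub0 : Term → ℕ → Term
  sub0 t zero    = t
  sub0 t (suc x) = var x

  inst : Formula → Term → Formula
  inst A t = subF (sub0 t) A

  infixr 8 _∧ε_
  infixr 7 _∨ε_
  infixr 6 _⇒ε_

  mutual
    data ETerm : Set where
      var : ℕ → ETerm
      fun : (f : Fun) → Vec ETerm (funAr f) → ETerm
      eps : EFormula → ETerm          -- ε_x A(x), x = index 0

    data EFormula : Set where
      atom  : (p : Pred) → Vec ETerm (predAr p) → EFormula
      _∧ε_  : EFormula → EFormula → EFormula
      _∨ε_  : EFormula → EFormula → EFormula
      _⇒ε_  : EFormula → EFormula → EFormula
      ¬ε_   : EFormula → EFormula

  mutual
    erenT : (ℕ → ℕ) → ETerm → ETerm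
    erenT ρ (var x)    = var (ρ x)
    erenT ρ (fun f ts) = fun f (erenTs ρ ts)
    erenT ρ (eps A)    = eps (erenF (liftR ρ) A)

    erenTs : ∀ {k} → (ℕ → ℕ) → Vec ETerm k → Vec ETerm k
    erenTs ρ []       = []
    erenTs ρ (t ∷ ts) = erenT ρ t ∷ erenTs ρ ts

    erenF : (ℕ → ℕ) → EFormula → EFormula
    erenF ρ (atom p ts) = atom p (erenTs ρ ts)
    erenF ρ (A ∧ε B)    = erenF ρ A ∧ε erenF ρ B
    erenF ρ (A ∨ε B)    = erenF ρ A ∨ε erenF ρ B
    erenF ρ (A ⇒ε B)    = erenF ρ A ⇒ε erenF ρ B
    erenF ρ (¬ε A)      = ¬ε erenF ρ A

  eliftS : (ℕ → ETerm) → ℕ → ETerm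
  eliftS σ zero    = var zero
  eliftS σ (suc x) = erenT suc (σ x)

  mutual
    esubT : (ℕ → ETerm) → ETerm → ETerm
    esubT σ (var x)    = σ x
    esubT σ (fun f ts) = fun f (esubTs σ ts)
    esubT σ (eps A)    = eps (esubF (eliftS σ) A)

    esubTs : ∀ {k} → (ℕ → ETerm) → Vec ETerm k → Vec ETerm k
    esubTs σ []       = []
    esubTs σ (t ∷ ts) = esubT σ t ∷ esubTs σ ts

    esubF : (ℕ → ETerm) → EFormula → EFormula
    esubF σ (atom p ts) = atom p (esubTs σ ts)
    esubF σ (A ∧ε B)    = esubF σ A ∧ε esubF σ B
    esubF σ (A ∨ε B)    = esubF σ A ∨ε esubF σ B
    esubF σ (A ⇒ε B)    = esubF σ A ⇒ε esubF σ B
    esubF σ (¬ε A)      = ¬ε esubF σ A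

  esub0 : ETerm → ℕ → ETerm
  esub0 t zero    = t
  esub0 t (suc x) = var x

  einst : EFormula → ETerm → EFormula
  einst A t = esubF (esub0 t) A

  mutual
    embT : Term → ETerm
    embT (var x)    = var x
    embT (fun f ts) = fun f (embTs ts)

    embTs : ∀ {k} → Vec Term k → Vec ETerm k
    embTs []       = []
    embTs (t ∷ ts) = embT t ∷ embTs ts

  -- [∃x A'(x)]^ε = [A'](ε_x [A'](x)),  [∀x A'(x)]^ε = [A'](ε_x ¬[A'](x))
  -- (the translation commutes with substitution of epsilon terms)
  trε : Formula → EFormula
  trε (atom p ts) = atom p (embTs ts)
  trε (A ∧' B)    = trε A ∧ε trε B
  trε (A ∨' B)    = trε A ∨ε trε B
  trε (A ⇒' B)    = trε A ⇒ε trε B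
  trε (¬' A)      = ¬ε trε A
  trε (∀' A)      = einst (trε A) (eps (¬ε trε A))
  trε (∃' A)      = einst (trε A) (eps (trε A))

  trεs : List Formula → List EFormula
  trεs = map trε

  -- LK  (sequents are multisets: lists modulo the cost-free rule `perm`)

  data LK : List Formula → List Formula → Set where
    ax   : ∀ {p ts} → LK (atom p ts ∷ []) (atom p ts ∷ [])
    perm : ∀ {Γ Γ' Δ Δ'} → Γ ↭ Γ' → Δ ↭ Δ' → LK Γ Δ → LK Γ' Δ'
    wl   : ∀ {A Γ Δ} → LK Γ Δ → LK (A ∷ Γ) Δ
    wr   : ∀ {A Γ Δ} → LK Γ Δ → LK Γ (A ∷ Δ)
    cl   : ∀ {A Γ Δ} → LK (A ∷ A ∷ Γ) Δ → LK (A ∷ Γ) Δ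
    cr   : ∀ {A Γ Δ} → LK Γ (A ∷ A ∷ Δ) → LK Γ (A ∷ Δ)
    cut  : ∀ {A Γ₁ Γ₂ Δ₁ Δ₂} → LK Γ₁ (A ∷ Δ₁) → LK (A ∷ Γ₂) Δ₂
         → LK (Γ₁ ++ Γ₂) (Δ₁ ++ Δ₂)
    ∧l₁  : ∀ {A B Γ Δ} → LK (A ∷ Γ) Δ → LK (A ∧' B ∷ Γ) Δ
    ∧l₂  : ∀ {A B Γ Δ} → LK (B ∷ Γ) Δ → LK (A ∧' B ∷ Γ) Δ
    ∧r   : ∀ {A B Γ₁ Γ₂ Δ₁ Δ₂} → LK Γ₁ (A ∷ Δ₁) → LK Γ₂ (B ∷ Δ₂)
         → LK (Γ₁ ++ Γ₂) (A ∧' B ∷ Δ₁ ++ Δ₂)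
    ∨l   : ∀ {A B Γ₁ Γ₂ Δ₁ Δ₂} → LK (A ∷ Γ₁) Δ₁ → LK (B ∷ Γ₂) Δ₂
         → LK (A ∨' B ∷ Γ₁ ++ Γ₂) (Δ₁ ++ Δ₂)
    ∨r₁  : ∀ {A B Γ Δ} → LK Γ (A ∷ Δ) → LK Γ (A ∨' B ∷ Δ)
    ∨r₂  : ∀ {A B Γ Δ} → LK Γ (B ∷ Δ) → LK Γ (A ∨' B ∷ Δ)
    ⇒l   : ∀ {A B Γ₁ Γ₂ Δ₁ Δ₂} → LK Γ₁ (A ∷ Δ₁) → LK (B ∷ Γ₂) Δ₂
         → LK (A ⇒' B ∷ Γ₁ ++ Γ₂) (Δ₁ ++ Δ₂)
    ⇒r   : ∀ {A B Γ Δ} → LK (A ∷ Γ) (B ∷ Δ) → LK Γ (A ⇒' B ∷ Δ)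
    ¬l   : ∀ {A Γ Δ} → LK Γ (A ∷ Δ) → LK (¬' A ∷ Γ) Δ
    ¬r   : ∀ {A Γ Δ} → LK (A ∷ Γ) Δ → LK Γ (¬' A ∷ Δ)
    ∃r   : ∀ {A Γ Δ} (t : Term) → LK Γ (inst A t ∷ Δ) → LK Γ (∃' A ∷ Δ)
    ∀l   : ∀ {A Γ Δ} (t : Term) → LK (inst A t ∷ Γ) Δ → LK (∀' A ∷ Γ) Δ
    -- strong quantifier rules: eigenvariable = index 0, fresh for the
    -- shifted context (de Bruijn form of the eigenvariable condition)
    ∀r   : ∀ {A Γ Δ} → LK (map shiftF Γ) (A ∷ map shiftF Δ) → LK Γ (∀' A ∷ Δ)
    ∃l   : ∀ {A Γ Δ} → LK (A ∷ map shiftF Γ) (map shiftF Δ) → LK (∃' A ∷ Γ) Δ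

  data Lε : List EFormula → List EFormula → Set where
    ax   : ∀ {p ts} → Lε (atom p ts ∷ []) (atom p ts ∷ [])
    perm : ∀ {Γ Γ' Δ Δ'} → Γ ↭ Γ' → Δ ↭ Δ' → Lε Γ Δ → Lε Γ' Δ'
    wl   : ∀ {A Γ Δ} → Lε Γ Δ → Lε (A ∷ Γ) Δ
    wr   : ∀ {A Γ Δ} → Lε Γ Δ → Lε Γ (A ∷ Δ)
    cl   : ∀ {A Γ Δ} → Lε (A ∷ A ∷ Γ) Δ → Lε (A ∷ Γ) Δ
    cr   : ∀ {A Γ Δ} → Lε Γ (A ∷ A ∷ Δ) → Lε Γ (A ∷ Δ)
    cut  : ∀ {A Γ₁ Γ₂ Δ₁ Δ₂} → Lε Γ₁ (A ∷ Δ₁) → Lε (A ∷ Γ₂) Δ₂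
         → Lε (Γ₁ ++ Γ₂) (Δ₁ ++ Δ₂)
    ∧l₁  : ∀ {A B Γ Δ} → Lε (A ∷ Γ) Δ → Lε (A ∧ε B ∷ Γ) Δ
    ∧l₂  : ∀ {A B Γ Δ} → Lε (B ∷ Γ) Δ → Lε (A ∧ε B ∷ Γ) Δ
    ∧r   : ∀ {A B Γ₁ Γ₂ Δ₁ Δ₂} → Lε Γ₁ (A ∷ Δ₁) → Lε Γ₂ (B ∷ Δ₂)
         → Lε (Γ₁ ++ Γ₂) (A ∧ε B ∷ Δ₁ ++ Δ₂)
    ∨l   : ∀ {A B Γ₁ Γ₂ Δ₁ Δ₂} → Lε (A ∷ Γ₁) Δ₁ → Lε (B ∷ Γ₂) Δ₂
         → Lε (A ∨ε B ∷ Γ₁ ++ Γ₂) (Δ₁ ++ Δ₂)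
    ∨r₁  : ∀ {A B Γ Δ} → Lε Γ (A ∷ Δ) → Lε Γ (A ∨ε B ∷ Δ)
    ∨r₂  : ∀ {A B Γ Δ} → Lε Γ (B ∷ Δ) → Lε Γ (A ∨ε B ∷ Δ)
    ⇒l   : ∀ {A B Γ₁ Γ₂ Δ₁ Δ₂} → Lε Γ₁ (A ∷ Δ₁) → Lε (B ∷ Γ₂) Δ₂
         → Lε (A ⇒ε B ∷ Γ₁ ++ Γ₂) (Δ₁ ++ Δ₂)
    ⇒r   : ∀ {A B Γ Δ} → Lε (A ∷ Γ) (B ∷ Δ) → Lε Γ (A ⇒ε B ∷ Δ)
    ¬l   : ∀ {A Γ Δ} → Lε Γ (A ∷ Δ) → Lε (¬ε A ∷ Γ) Δ
    ¬r   : ∀ {A Γ Δ} → Lε (A ∷ Γ) Δ → Lε Γ (¬ε A ∷ Δ)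
    ∃r   : ∀ {A Γ Δ} (t : ETerm) → Lε Γ (einst A t ∷ Δ)
         → Lε Γ (einst A (eps A) ∷ Δ)
    ∀l   : ∀ {A Γ Δ} (t : ETerm) → Lε (einst A t ∷ Γ) Δ
         → Lε (einst A (eps (¬ε A)) ∷ Γ) Δ

  lenLK : ∀ {Γ Δ} → LK Γ Δ → ℕ
  lenLK ax           = 0
  lenLK (perm _ _ d) = lenLK d
  lenLK (wl d)       = suc (lenLK d)
  lenLK (wr d)       = suc (lenLK d)
  lenLK (cl d)       = suc (lenLK d)
  lenLK (cr d)       = suc (lenLK d)
  lenLK (cut d e)    = suc (lenLK d + lenLK e)
  lenLK (∧l₁ d)      = suc (lenLK d)
  lenLK (∧l₂ d)      = suc (lenLK d)
  lenLK (∧r d e)     = suc (lenLK d + lenLK e)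
  lenLK (∨l d e)     = suc (lenLK d + lenLK e)
  lenLK (∨r₁ d)      = suc (lenLK d)
  lenLK (∨r₂ d)      = suc (lenLK d)
  lenLK (⇒l d e)     = suc (lenLK d + lenLK e)
  lenLK (⇒r d)       = suc (lenLK d)
  lenLK (¬l d)       = suc (lenLK d)
  lenLK (¬r d)       = suc (lenLK d)
  lenLK (∃r _ d)     = suc (lenLK d)
  lenLK (∀l _ d)     = suc (lenLK d)
  lenLK (∀r d)       = suc (lenLK d)
  lenLK (∃l d)       = suc (lenLK d)

  lenLε : ∀ {Γ Δ} → Lε Γ Δ → ℕ
  lenLε ax           = 0
  lenLε (perm _ _ d) = lenLε d
  lenLε (wl d)       = suc (lenLε d)
  lenLε (wr d)       = suc (lenLε d)
  lenLε (cl d)       = suc (lenLε d)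
  lenLε (cr d)       = suc (lenLε d)
  lenLε (cut d e)    = suc (lenLε d + lenLε e)
  lenLε (∧l₁ d)      = suc (lenLε d)
  lenLε (∧l₂ d)      = suc (lenLε d)
  lenLε (∧r d e)     = suc (lenLε d + lenLε e)
  lenLε (∨l d e)     = suc (lenLε d + lenLε e)
  lenLε (∨r₁ d)      = suc (lenLε d)
  lenLε (∨r₂ d)      = suc (lenLε d)
  lenLε (⇒l d e)     = suc (lenLε d + lenLε e)
  lenLε (⇒r d)       = suc (lenLε d)
  lenLε (¬l d)       = suc (lenLε d)
  lenLε (¬r d)       = suc (lenLε d)
  lenLε (∃r _ d)     = suc (lenLε d)
  lenLε (∀l _ d)     = suc (lenLε d)

-- A strong quantifier inference is not translated at all: the eigenvariable
-- of ∀x A(x) (resp. ∃x A(x)) is replaced everywhere in the subderivation by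
-- ε_x ¬[A](x) (resp. ε_x [A](x)), which turns the premise into the conclusion.
-- Hence one translates an LK-derivation under an arbitrary epsilon
-- substitution σ, by induction; weak quantifier inferences become ε-inferences
-- because the translation commutes with substitution, every other inference
-- is kept, and the strong ones disappear, so the length never grows.
module Submission where

open import Defs
open import Data.Nat using (ℕ; zero; suc; _+_; _≤_; z≤n; s≤s)
open import Data.Nat.Properties using (+-mono-≤; m≤n⇒m≤1+n)
open import Data.Product using (Σ; _,_; map₂)
import Data.Product as Product
open import Data.List using (List; []; _∷_; _++_; map)
open import Data.List.Properties using (map-++; map-∘; map-cong)
open import Data.List.Relation.Binary.Permutation.Propositional.Properties using (map⁺)
open import Data.Vec using (Vec; []; _∷_)
open import Function using (_∘_; id)
open import Relation.Binary.PropositionalEquality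
open ≡-Reasoning

module _ (S : Sig) where

  liftR-cong : ∀ {ρ ρ'} → ρ ≗ ρ' → liftR S ρ ≗ liftR S ρ'
  liftR-cong h zero    = refl
  liftR-cong h (suc x) = cong suc (h x)

  mutual
    erenT-cong : ∀ {ρ ρ'} → ρ ≗ ρ' → erenT S ρ ≗ erenT S ρ'
    erenT-cong h (var x)    = cong var (h x)
    erenT-cong h (fun f ts) = cong (fun f) (erenTs-cong h ts)
    erenT-cong h (eps A)    = cong eps (erenF-cong (liftR-cong h) A)

    erenTs-cong : ∀ {k ρ ρ'} → ρ ≗ ρ' → erenTs S {k} ρ ≗ erenTs S ρ'
    erenTs-cong h []       = refl
    erenTs-cong h (t ∷ ts) = cong₂ _∷_ (erenT-cong h t) (erenTs-cong h ts)

    erenF-cong : ∀ {ρ ρ'} → ρ ≗ ρ' → erenF S ρ ≗ erenF S ρ'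
    erenF-cong h (atom p ts) = cong (atom p) (erenTs-cong h ts)
    erenF-cong h (A ∧ε B)    = cong₂ _∧ε_ (erenF-cong h A) (erenF-cong h B)
    erenF-cong h (A ∨ε B)    = cong₂ _∨ε_ (erenF-cong h A) (erenF-cong h B)
    erenF-cong h (A ⇒ε B)    = cong₂ _⇒ε_ (erenF-cong h A) (erenF-cong h B)
    erenF-cong h (¬ε A)      = cong ¬ε_ (erenF-cong h A)

  eliftS-cong : ∀ {σ σ'} → σ ≗ σ' → eliftS S σ ≗ eliftS S σ'
  eliftS-cong h zero    = refl
  eliftS-cong h (suc x) = cong (erenT S suc) (h x)

  mutual
    esubT-cong : ∀ {σ σ'} → σ ≗ σ' → esubT S σ ≗ esubT S σ'
    esubT-cong h (var x)    = h x
    esubT-cong h (fun f ts) = cong (fun f) (esubTs-cong h ts)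
    esubT-cong h (eps A)    = cong eps (esubF-cong (eliftS-cong h) A)

    esubTs-cong : ∀ {k σ σ'} → σ ≗ σ' → esubTs S {k} σ ≗ esubTs S σ'
    esubTs-cong h []       = refl
    esubTs-cong h (t ∷ ts) = cong₂ _∷_ (esubT-cong h t) (esubTs-cong h ts)

    esubF-cong : ∀ {σ σ'} → σ ≗ σ' → esubF S σ ≗ esubF S σ'
    esubF-cong h (atom p ts) = cong (atom p) (esubTs-cong h ts)
    esubF-cong h (A ∧ε B)    = cong₂ _∧ε_ (esubF-cong h A) (esubF-cong h B)
    esubF-cong h (A ∨ε B)    = cong₂ _∨ε_ (esubF-cong h A) (esubF-cong h B)
    esubF-cong h (A ⇒ε B)    = cong₂ _⇒ε_ (esubF-cong h A) (esubF-cong h B)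
    esubF-cong h (¬ε A)      = cong ¬ε_ (esubF-cong h A)

  liftR-∘ : ∀ ρ τ → liftR S ρ ∘ liftR S τ ≗ liftR S (ρ ∘ τ)
  liftR-∘ ρ τ zero    = refl
  liftR-∘ ρ τ (suc x) = refl

  mutual
    erenT-erenT : ∀ ρ τ t → erenT S ρ (erenT S τ t) ≡ erenT S (ρ ∘ τ) t
    erenT-erenT ρ τ (var x)    = refl
    erenT-erenT ρ τ (fun f ts) = cong (fun f) (erenTs-erenT ρ τ ts)
    erenT-erenT ρ τ (eps A)    = cong eps
      (trans (erenF-erenF (liftR S ρ) (liftR S τ) A) (erenF-cong (liftR-∘ ρ τ) A))

    erenTs-erenT : ∀ {k} ρ τ (ts : Vec (ETerm S) k)
      → erenTs S ρ (erenTs S τ ts) ≡ erenTs S (ρ ∘ τ) ts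
    erenTs-erenT ρ τ []       = refl
    erenTs-erenT ρ τ (t ∷ ts) = cong₂ _∷_ (erenT-erenT ρ τ t) (erenTs-erenT ρ τ ts)

    erenF-erenF : ∀ ρ τ A → erenF S ρ (erenF S τ A) ≡ erenF S (ρ ∘ τ) A
    erenF-erenF ρ τ (atom p ts) = cong (atom p) (erenTs-erenT ρ τ ts)
    erenF-erenF ρ τ (A ∧ε B)    = cong₂ _∧ε_ (erenF-erenF ρ τ A) (erenF-erenF ρ τ B)
    erenF-erenF ρ τ (A ∨ε B)    = cong₂ _∨ε_ (erenF-erenF ρ τ A) (erenF-erenF ρ τ B)
    erenF-erenF ρ τ (A ⇒ε B)    = cong₂ _⇒ε_ (erenF-erenF ρ τ A) (erenF-erenF ρ τ B)
    erenF-erenF ρ τ (¬ε A)      = cong ¬ε_ (erenF-erenF ρ τ A)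

  erenT-eliftS : ∀ ρ σ → erenT S (liftR S ρ) ∘ eliftS S σ ≗ eliftS S (erenT S ρ ∘ σ)
  erenT-eliftS ρ σ zero    = refl
  erenT-eliftS ρ σ (suc x) =
    trans (erenT-erenT (liftR S ρ) suc (σ x)) (sym (erenT-erenT suc ρ (σ x)))

  mutual
    erenT-esubT : ∀ ρ σ t → erenT S ρ (esubT S σ t) ≡ esubT S (erenT S ρ ∘ σ) t
    erenT-esubT ρ σ (var x)    = refl
    erenT-esubT ρ σ (fun f ts) = cong (fun f) (erenTs-esubTs ρ σ ts)
    erenT-esubT ρ σ (eps A)    = cong eps
      (trans (erenF-esubF (liftR S ρ) (eliftS S σ) A) (esubF-cong (erenT-eliftS ρ σ) A))

    erenTs-esubTs : ∀ {k} ρ σ (ts : Vec (ETerm S) k)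
      → erenTs S ρ (esubTs S σ ts) ≡ esubTs S (erenT S ρ ∘ σ) ts
    erenTs-esubTs ρ σ []       = refl
    erenTs-esubTs ρ σ (t ∷ ts) = cong₂ _∷_ (erenT-esubT ρ σ t) (erenTs-esubTs ρ σ ts)

    erenF-esubF : ∀ ρ σ A → erenF S ρ (esubF S σ A) ≡ esubF S (erenT S ρ ∘ σ) A
    erenF-esubF ρ σ (atom p ts) = cong (atom p) (erenTs-esubTs ρ σ ts)
    erenF-esubF ρ σ (A ∧ε B)    = cong₂ _∧ε_ (erenF-esubF ρ σ A) (erenF-esubF ρ σ B)
    erenF-esubF ρ σ (A ∨ε B)    = cong₂ _∨ε_ (erenF-esubF ρ σ A) (erenF-esubF ρ σ B)
    erenF-esubF ρ σ (A ⇒ε B)    = cong₂ _⇒ε_ (erenF-esubF ρ σ A) (erenF-esubF ρ σ B)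
    erenF-esubF ρ σ (¬ε A)      = cong ¬ε_ (erenF-esubF ρ σ A)

  eliftS-liftR : ∀ σ ρ → eliftS S σ ∘ liftR S ρ ≗ eliftS S (σ ∘ ρ)
  eliftS-liftR σ ρ zero    = refl
  eliftS-liftR σ ρ (suc x) = refl

  mutual
    esubT-erenT : ∀ σ ρ t → esubT S σ (erenT S ρ t) ≡ esubT S (σ ∘ ρ) t
    esubT-erenT σ ρ (var x)    = refl
    esubT-erenT σ ρ (fun f ts) = cong (fun f) (esubTs-erenTs σ ρ ts)
    esubT-erenT σ ρ (eps A)    = cong eps
      (trans (esubF-erenF (eliftS S σ) (liftR S ρ) A) (esubF-cong (eliftS-liftR σ ρ) A))

    esubTs-erenTs : ∀ {k} σ ρ (ts : Vec (ETerm S) k)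
      → esubTs S σ (erenTs S ρ ts) ≡ esubTs S (σ ∘ ρ) ts
    esubTs-erenTs σ ρ []       = refl
    esubTs-erenTs σ ρ (t ∷ ts) = cong₂ _∷_ (esubT-erenT σ ρ t) (esubTs-erenTs σ ρ ts)

    esubF-erenF : ∀ σ ρ A → esubF S σ (erenF S ρ A) ≡ esubF S (σ ∘ ρ) A
    esubF-erenF σ ρ (atom p ts) = cong (atom p) (esubTs-erenTs σ ρ ts)
    esubF-erenF σ ρ (A ∧ε B)    = cong₂ _∧ε_ (esubF-erenF σ ρ A) (esubF-erenF σ ρ B)
    esubF-erenF σ ρ (A ∨ε B)    = cong₂ _∨ε_ (esubF-erenF σ ρ A) (esubF-erenF σ ρ B)
    esubF-erenF σ ρ (A ⇒ε B)    = cong₂ _⇒ε_ (esubF-erenF σ ρ A) (esubF-erenF σ ρ B)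
    esubF-erenF σ ρ (¬ε A)      = cong ¬ε_ (esubF-erenF σ ρ A)

  esubT-eliftS : ∀ σ τ → esubT S (eliftS S σ) ∘ eliftS S τ ≗ eliftS S (esubT S σ ∘ τ)
  esubT-eliftS σ τ zero    = refl
  esubT-eliftS σ τ (suc x) =
    trans (esubT-erenT (eliftS S σ) suc (τ x)) (sym (erenT-esubT suc σ (τ x)))

  mutual
    esubT-esubT : ∀ σ τ t → esubT S σ (esubT S τ t) ≡ esubT S (esubT S σ ∘ τ) t
    esubT-esubT σ τ (var x)    = refl
    esubT-esubT σ τ (fun f ts) = cong (fun f) (esubTs-esubTs σ τ ts)
    esubT-esubT σ τ (eps A)    = cong eps
      (trans (esubF-esubF (eliftS S σ) (eliftS S τ) A) (esubF-cong (esubT-eliftS σ τ) A))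

    esubTs-esubTs : ∀ {k} σ τ (ts : Vec (ETerm S) k)
      → esubTs S σ (esubTs S τ ts) ≡ esubTs S (esubT S σ ∘ τ) ts
    esubTs-esubTs σ τ []       = refl
    esubTs-esubTs σ τ (t ∷ ts) = cong₂ _∷_ (esubT-esubT σ τ t) (esubTs-esubTs σ τ ts)

    esubF-esubF : ∀ σ τ A → esubF S σ (esubF S τ A) ≡ esubF S (esubT S σ ∘ τ) A
    esubF-esubF σ τ (atom p ts) = cong (atom p) (esubTs-esubTs σ τ ts)
    esubF-esubF σ τ (A ∧ε B)    = cong₂ _∧ε_ (esubF-esubF σ τ A) (esubF-esubF σ τ B)
    esubF-esubF σ τ (A ∨ε B)    = cong₂ _∨ε_ (esubF-esubF σ τ A) (esubF-esubF σ τ B)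
    esubF-esubF σ τ (A ⇒ε B)    = cong₂ _⇒ε_ (esubF-esubF σ τ A) (esubF-esubF σ τ B)
    esubF-esubF σ τ (¬ε A)      = cong ¬ε_ (esubF-esubF σ τ A)

  eliftS-var : eliftS S var ≗ var
  eliftS-var zero    = refl
  eliftS-var (suc x) = refl

  mutual
    esubT-var : ∀ t → esubT S var t ≡ t
    esubT-var (var x)    = refl
    esubT-var (fun f ts) = cong (fun f) (esubTs-var ts)
    esubT-var (eps A)    = cong eps (trans (esubF-cong eliftS-var A) (esubF-var A))

    esubTs-var : ∀ {k} (ts : Vec (ETerm S) k) → esubTs S var ts ≡ ts
    esubTs-var []       = refl
    esubTs-var (t ∷ ts) = cong₂ _∷_ (esubT-var t) (esubTs-var ts)

    esubF-var : ∀ A → esubF S var A ≡ A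
    esubF-var (atom p ts) = cong (atom p) (esubTs-var ts)
    esubF-var (A ∧ε B)    = cong₂ _∧ε_ (esubF-var A) (esubF-var B)
    esubF-var (A ∨ε B)    = cong₂ _∨ε_ (esubF-var A) (esubF-var B)
    esubF-var (A ⇒ε B)    = cong₂ _⇒ε_ (esubF-var A) (esubF-var B)
    esubF-var (¬ε A)      = cong ¬ε_ (esubF-var A)

  erenF-einst : ∀ ρ A u
    → erenF S ρ (einst S A u) ≡ einst S (erenF S (liftR S ρ) A) (erenT S ρ u)
  erenF-einst ρ A u = begin
    erenF S ρ (esubF S (esub0 S u) A)              ≡⟨ erenF-esubF ρ (esub0 S u) A ⟩
    esubF S (erenT S ρ ∘ esub0 S u) A              ≡⟨ esubF-cong commute A ⟩
    esubF S (esub0 S (erenT S ρ u) ∘ liftR S ρ) A  ≡⟨ esubF-erenF _ (liftR S ρ) A ⟨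
    einst S (erenF S (liftR S ρ) A) (erenT S ρ u)  ∎
    where
    commute : erenT S ρ ∘ esub0 S u ≗ esub0 S (erenT S ρ u) ∘ liftR S ρ
    commute zero    = refl
    commute (suc x) = refl

  esubF-einst : ∀ σ A u
    → esubF S σ (einst S A u) ≡ einst S (esubF S (eliftS S σ) A) (esubT S σ u)
  esubF-einst σ A u = begin
    esubF S σ (esubF S (esub0 S u) A)                         ≡⟨ esubF-esubF σ (esub0 S u) A ⟩
    esubF S (esubT S σ ∘ esub0 S u) A                         ≡⟨ esubF-cong commute A ⟩
    esubF S (esubT S (esub0 S (esubT S σ u)) ∘ eliftS S σ) A  ≡⟨ esubF-esubF _ (eliftS S σ) A ⟨
    einst S (esubF S (eliftS S σ) A) (esubT S σ u)            ∎
    where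
    commute : esubT S σ ∘ esub0 S u ≗ esubT S (esub0 S (esubT S σ u)) ∘ eliftS S σ
    commute zero    = refl
    commute (suc x) = sym (trans (esubT-erenT _ suc (σ x)) (esubT-var (σ x)))

  mutual
    embT-renT : ∀ ρ t → embT S (renT S ρ t) ≡ erenT S ρ (embT S t)
    embT-renT ρ (var x)    = refl
    embT-renT ρ (fun f ts) = cong (fun f) (embTs-renTs ρ ts)

    embTs-renTs : ∀ {k} ρ (ts : Vec (Term S) k) → embTs S (renTs S ρ ts) ≡ erenTs S ρ (embTs S ts)
    embTs-renTs ρ []       = refl
    embTs-renTs ρ (t ∷ ts) = cong₂ _∷_ (embT-renT ρ t) (embTs-renTs ρ ts)

  mutual
    embT-subT : ∀ s t → embT S (subT S s t) ≡ esubT S (embT S ∘ s) (embT S t)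
    embT-subT s (var x)    = refl
    embT-subT s (fun f ts) = cong (fun f) (embTs-subTs s ts)

    embTs-subTs : ∀ {k} s (ts : Vec (Term S) k)
      → embTs S (subTs S s ts) ≡ esubTs S (embT S ∘ s) (embTs S ts)
    embTs-subTs s []       = refl
    embTs-subTs s (t ∷ ts) = cong₂ _∷_ (embT-subT s t) (embTs-subTs s ts)

  trε-renF : ∀ ρ A → trε S (renF S ρ A) ≡ erenF S ρ (trε S A)
  trε-renF ρ (atom p ts) = cong (atom p) (embTs-renTs ρ ts)
  trε-renF ρ (A ∧' B)    = cong₂ _∧ε_ (trε-renF ρ A) (trε-renF ρ B)
  trε-renF ρ (A ∨' B)    = cong₂ _∨ε_ (trε-renF ρ A) (trε-renF ρ B)
  trε-renF ρ (A ⇒' B)    = cong₂ _⇒ε_ (trε-renF ρ A) (trε-renF ρ B)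
  trε-renF ρ (¬' A)      = cong ¬ε_ (trε-renF ρ A)
  trε-renF ρ (∀' A)      = trans (cong (λ B → einst S B (eps (¬ε B))) (trε-renF (liftR S ρ) A))
                                 (sym (erenF-einst ρ (trε S A) (eps (¬ε trε S A))))
  trε-renF ρ (∃' A)      = trans (cong (λ B → einst S B (eps B)) (trε-renF (liftR S ρ) A))
                                 (sym (erenF-einst ρ (trε S A) (eps (trε S A))))

  embT-liftS : ∀ s → embT S ∘ liftS S s ≗ eliftS S (embT S ∘ s)
  embT-liftS s zero    = refl
  embT-liftS s (suc x) = embT-renT suc (s x)

  mutual
    trε-subF : ∀ s A → trε S (subF S s A) ≡ esubF S (embT S ∘ s) (trε S A)
    trε-subF s (atom p ts) = cong (atom p) (embTs-subTs s ts)
    trε-subF s (A ∧' B)    = cong₂ _∧ε_ (trε-subF s A) (trε-subF s B)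
    trε-subF s (A ∨' B)    = cong₂ _∨ε_ (trε-subF s A) (trε-subF s B)
    trε-subF s (A ⇒' B)    = cong₂ _⇒ε_ (trε-subF s A) (trε-subF s B)
    trε-subF s (¬' A)      = cong ¬ε_ (trε-subF s A)
    trε-subF s (∀' A)      = trans (cong (λ B → einst S B (eps (¬ε B))) (trε-subF-lift s A))
                                   (sym (esubF-einst (embT S ∘ s) (trε S A) (eps (¬ε trε S A))))
    trε-subF s (∃' A)      = trans (cong (λ B → einst S B (eps B)) (trε-subF-lift s A))
                                   (sym (esubF-einst (embT S ∘ s) (trε S A) (eps (trε S A))))

    trε-subF-lift : ∀ s A
      → trε S (subF S (liftS S s) A) ≡ esubF S (eliftS S (embT S ∘ s)) (trε S A)
    trε-subF-lift s A = trans (trε-subF (liftS S s) A) (esubF-cong (embT-liftS s) (trε S A))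

  trε-inst : ∀ A t → trε S (inst S A t) ≡ einst S (trε S A) (embT S t)
  trε-inst A t = trans (trε-subF (sub0 S t) A) (esubF-cong embT-sub0 (trε S A))
    where
    embT-sub0 : embT S ∘ sub0 S t ≗ esub0 S (embT S t)
    embT-sub0 zero    = refl
    embT-sub0 (suc x) = refl

  trεₛ : (ℕ → ETerm S) → Formula S → EFormula S
  trεₛ σ = esubF S σ ∘ trε S

  -- Used on the premise of a strong rule: σ on the shifted context, u for the eigenvariable.
  _◂_ : (ℕ → ETerm S) → ETerm S → ℕ → ETerm S
  σ ◂ u = esubT S σ ∘ esub0 S u

  trεₛ-inst : ∀ σ A t
    → trεₛ σ (inst S A t) ≡ einst S (esubF S (eliftS S σ) (trε S A)) (esubT S σ (embT S t))
  trεₛ-inst σ A t =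
    trans (cong (esubF S σ) (trε-inst A t)) (esubF-einst σ (trε S A) (embT S t))

  trεₛ-∃' : ∀ σ A → let B = esubF S (eliftS S σ) (trε S A) in trεₛ σ (∃' A) ≡ einst S B (eps B)
  trεₛ-∃' σ A = esubF-einst σ (trε S A) (eps (trε S A))

  trεₛ-∀' : ∀ σ A → let B = esubF S (eliftS S σ) (trε S A) in trεₛ σ (∀' A) ≡ einst S B (eps (¬ε B))
  trεₛ-∀' σ A = esubF-einst σ (trε S A) (eps (¬ε trε S A))

  trεₛ-◂ : ∀ σ u A → trεₛ (σ ◂ u) A ≡ esubF S σ (einst S (trε S A) u)
  trεₛ-◂ σ u A = sym (esubF-esubF σ (esub0 S u) (trε S A))

  trεₛ-◂-shiftF : ∀ σ u Γ → map (trεₛ (σ ◂ u)) (map (shiftF S) Γ) ≡ map (trεₛ σ) Γ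
  trεₛ-◂-shiftF σ u Γ = trans (sym (map-∘ Γ)) (map-cong shifted Γ)
    where
    shifted : trεₛ (σ ◂ u) ∘ shiftF S ≗ trεₛ σ
    shifted B =
      trans (cong (esubF S (σ ◂ u)) (trε-renF suc B)) (esubF-erenF (σ ◂ u) suc (trε S B))

  Lε≤ : List (EFormula S) → List (EFormula S) → ℕ → Set
  Lε≤ Γ Δ n = Σ (Lε S Γ Δ) (λ e → lenLε S e ≤ n)

  Lε≤-cast : ∀ {Γ Γ' Δ Δ' n} → Γ ≡ Γ' → Δ ≡ Δ' → Lε≤ Γ Δ n → Lε≤ Γ' Δ' n
  Lε≤-cast refl refl e = e

  suc-+-mono-≤ : ∀ {a b c d} → a ≤ b → c ≤ d → suc (a + c) ≤ suc (b + d)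
  suc-+-mono-≤ p q = s≤s (+-mono-≤ p q)

  translate : ∀ σ {Γ Δ} (d : LK S Γ Δ) → Lε≤ (map (trεₛ σ) Γ) (map (trεₛ σ) Δ) (lenLK S d)
  translate σ ax           = ax , z≤n
  translate σ (perm p q d) =
    Product.map (perm (map⁺ (trεₛ σ) p) (map⁺ (trεₛ σ) q)) id (translate σ d)
  translate σ (wl d)       = Product.map wl s≤s (translate σ d)
  translate σ (wr d)       = Product.map wr s≤s (translate σ d)
  translate σ (cl d)       = Product.map cl s≤s (translate σ d)
  translate σ (cr d)       = Product.map cr s≤s (translate σ d)
  translate σ (∧l₁ d)      = Product.map ∧l₁ s≤s (translate σ d)
  translate σ (∧l₂ d)      = Product.map ∧l₂ s≤s (translate σ d)
  translate σ (∨r₁ d)      = Product.map ∨r₁ s≤s (translate σ d)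
  translate σ (∨r₂ d)      = Product.map ∨r₂ s≤s (translate σ d)
  translate σ (⇒r d)       = Product.map ⇒r s≤s (translate σ d)
  translate σ (¬l d)       = Product.map ¬l s≤s (translate σ d)
  translate σ (¬r d)       = Product.map ¬r s≤s (translate σ d)
  translate σ (cut {Γ₁ = Γ₁} {Γ₂} {Δ₁} {Δ₂} d d') =
    Lε≤-cast (sym (map-++ (trεₛ σ) Γ₁ Γ₂)) (sym (map-++ (trεₛ σ) Δ₁ Δ₂))
      (Product.zip cut suc-+-mono-≤ (translate σ d) (translate σ d'))
  translate σ (∧r {Γ₁ = Γ₁} {Γ₂} {Δ₁} {Δ₂} d d') =
    Lε≤-cast (sym (map-++ (trεₛ σ) Γ₁ Γ₂)) (cong (_ ∷_) (sym (map-++ (trεₛ σ) Δ₁ Δ₂)))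
      (Product.zip ∧r suc-+-mono-≤ (translate σ d) (translate σ d'))
  translate σ (∨l {Γ₁ = Γ₁} {Γ₂} {Δ₁} {Δ₂} d d') =
    Lε≤-cast (cong (_ ∷_) (sym (map-++ (trεₛ σ) Γ₁ Γ₂))) (sym (map-++ (trεₛ σ) Δ₁ Δ₂))
      (Product.zip ∨l suc-+-mono-≤ (translate σ d) (translate σ d'))
  translate σ (⇒l {Γ₁ = Γ₁} {Γ₂} {Δ₁} {Δ₂} d d') =
    Lε≤-cast (cong (_ ∷_) (sym (map-++ (trεₛ σ) Γ₁ Γ₂))) (sym (map-++ (trεₛ σ) Δ₁ Δ₂))
      (Product.zip ⇒l suc-+-mono-≤ (translate σ d) (translate σ d'))
  translate σ (∃r {A} {Δ = Δ} t d) =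
    Lε≤-cast refl (cong (_∷ map (trεₛ σ) Δ) (sym (trεₛ-∃' σ A)))
      (Product.map (∃r _) s≤s
        (Lε≤-cast refl (cong (_∷ map (trεₛ σ) Δ) (trεₛ-inst σ A t)) (translate σ d)))
  translate σ (∀l {A} {Γ} t d) =
    Lε≤-cast (cong (_∷ map (trεₛ σ) Γ) (sym (trεₛ-∀' σ A))) refl
      (Product.map (∀l _) s≤s
        (Lε≤-cast (cong (_∷ map (trεₛ σ) Γ) (trεₛ-inst σ A t)) refl (translate σ d)))
  translate σ (∀r {A} {Γ} {Δ} d) =
    Lε≤-cast (trεₛ-◂-shiftF σ u Γ) (cong₂ _∷_ (trεₛ-◂ σ u A) (trεₛ-◂-shiftF σ u Δ))
      (map₂ m≤n⇒m≤1+n (translate (σ ◂ u) d))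
    where u = eps (¬ε trε S A)
  translate σ (∃l {A} {Γ} {Δ} d) =
    Lε≤-cast (cong₂ _∷_ (trεₛ-◂ σ u A) (trεₛ-◂-shiftF σ u Γ)) (trεₛ-◂-shiftF σ u Δ)
      (map₂ m≤n⇒m≤1+n (translate (σ ◂ u) d))
    where u = eps (trε S A)

  map-trεₛ-var : ∀ Γ → map (trεₛ var) Γ ≡ trεs S Γ
  map-trεₛ-var = map-cong (esubF-var ∘ trε S)

proposition1 : (S : Sig) {Γ Δ : List (Formula S)} (d : LK S Γ Δ)
    → Σ (Lε S (trεs S Γ) (trεs S Δ)) (λ e → lenLε S e ≤ lenLK S d)
proposition1 S {Γ} {Δ} d = Lε≤-cast S (map-trεₛ-var S Γ) (map-trεₛ-var S Δ) (translate S var d)
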